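{- Let $T$ be an $n$-tournament with vertices $v_1,\dots,v_n$ such that $T[X]$ is transitive with $v_1\rightarrow v_2\rightarrow\dots\rightarrow v_{n-1}$, where $X=\{v_1,\dots,v_{n-1}\}$, and let $\psi_T(v_n,X)=(\alpha_1,\dots,\alpha_t)$ with corresponding blocks $X(1,\alpha_1),\dots,X(t,\alpha_t)$. If $D$ is a diamond in $T$ (an induced 4-subtournament that is a diamond), then $v_n\in V(D)$, and there exist $i_1<i_2<i_3$ in $\{1,\dots,t\}$ such that $|V(D)\cap X(i_j,\alpha_{i_j})|=1$ for $j=1,2,3$, $\alpha_{i_1}\alpha_{i_2}<0$ and $\alpha_{i_2}\alpha_{i_3}<0$.
   Context: A tournament is a directed graph with exactly one arc between each pair of distinct vertices; $u\rightarrow v$ means the arc goes from $u$ to $v$; $T[X]$ is the subtournament induced by $X$; a tournament is transitive if it has no directed 3-cycle. A diamond is a 4-tournament consisting of a directed 3-cycle together with a vertex that either dominates all three cycle vertices or is dominated by all three. Definition of $\psi$: if $T[X]$ is transitive with $|X|=k$, ordered $x_1,\dots,x_k$ with $x_a\rightarrow x_b$ for $a<b$, and $u\notin X$, then $\psi_T(u,X)=(\alpha_1,\dots,\alpha_t)$ is the sequence of nonzero integers with $|\alpha_1|+\dots+|\alpha_t|=k$ and $\alpha_i\alpha_{i+1}<0$ for $1\le i\le t-1$, such that, letting $X(1,\alpha_1)=\{x_1,\dots,x_{|\alpha_1|}\}$ and $X(j,\alpha_j)=\{x_{|\alpha_1|+\dots+|\alpha_{j-1}|+1},\dots,x_{|\alpha_1|+\dots+|\alpha_j|}\}$,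 $u$ dominates every vertex of $X(i,\alpha_i)$ when $\alpha_i>0$ and is dominated by every vertex of $X(i,\alpha_i)$ when $\alpha_i<0$. -}

module Defs where

open import Level using (0ℓ)
open import Data.Nat using (ℕ; suc; _≤_; _<_)
open import Data.Fin using (Fin; toℕ)
import Data.Fin as F
open import Data.Integer using (ℤ; ∣_∣; 0ℤ)
import Data.Integer as ℤ
open import Data.List using (List; []; _∷_; length; lookup; take)
open import Data.List.Membership.Propositional using (_∈_)
open import Data.Product using (_×_; ∃; ∃-syntax)
open import Data.Sum using (_⊎_)
open import Relation.Nullary using (¬_)
open import Relation.Binary.PropositionalEquality using (_≡_; _≢_)

record Tournament (n : ℕ) : Set₁ where
  field
    _⇒_    : Fin n → Fin n → Set
    irrefl : ∀ u → ¬ (u ⇒ u)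
    asym   : ∀ u v → u ⇒ v → ¬ (v ⇒ u)
    total  : ∀ u v → u ≢ v → (u ⇒ v) ⊎ (v ⇒ u)

absSum : List ℤ → ℕ
absSum []       = 0
absSum (α ∷ αs) = ∣ α ∣ Data.Nat.+ absSum αs

-- position k (0-based, into the ordering x₀,...,x_{m-1} of X) lies in block i
-- (0-based) X(i+1, α_{i+1}) determined by αs
InBlock : (αs : List ℤ) → Fin (length αs) → ℕ → Set
InBlock αs i k = absSum (take (toℕ i) αs) ≤ k × k < absSum (take (suc (toℕ i)) αs)

-- ψ_T(u, X) = αs, where X is listed in its transitive order by x : Fin m → Fin n
IsPsi : ∀ {n} (T : Tournament n) (u : Fin n) {m : ℕ} (x : Fin m → Fin n) (αs : List ℤ) → Set
IsPsi T u {m} x αs =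
    (∀ i → lookup αs i ≢ 0ℤ)
  × absSum αs ≡ m
  × (∀ (i j : Fin (length αs)) → toℕ j ≡ suc (toℕ i) → lookup αs i ℤ.* lookup αs j ℤ.< 0ℤ)
  × (∀ (i : Fin (length αs)) (k : Fin m) → InBlock αs i (toℕ k) →
        (0ℤ ℤ.< lookup αs i → u ⇒ x k) × (lookup αs i ℤ.< 0ℤ → x k ⇒ u))
  where open Tournament T

InBlockV : ∀ {n m} (x : Fin m → Fin n) (αs : List ℤ) → Fin (length αs) → Fin n → Set
InBlockV x αs i w = ∃[ k ] (x k ≡ w × InBlock αs i (toℕ k))

IsDiamond : ∀ {n} (T : Tournament n) (a b c d : Fin n) → Set
IsDiamond T a b c d =
    a ≢ b × a ≢ c × a ≢ d × b ≢ c × b ≢ d × c ≢ d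
  × a ⇒ b × b ⇒ c × c ⇒ a
  × ((d ⇒ a × d ⇒ b × d ⇒ c) ⊎ (a ⇒ d × b ⇒ d × c ⇒ d))
  where open Tournament T

-- |S ∩ X(i,α_i)| = 1 for S given as a list of distinct vertices
MeetsOnce : ∀ {n m} (x : Fin m → Fin n) (αs : List ℤ) → Fin (length αs) → List (Fin n) → Set
MeetsOnce x αs i S =
  ∃[ w ] (w ∈ S × InBlockV x αs i w × (∀ w′ → w′ ∈ S → InBlockV x αs i w′ → w′ ≡ w))

-- Since T[X] is transitive, the 3-cycle of a diamond D must pass through v_n. Going
-- around it, the other three vertices of D, read in the order of X, are alternately
-- dominated by and dominating v_n. The blocks X(i, α_i) are consecutive intervals of X,
-- and two vertices on which v_n acts in opposite directions never share a block, so these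
-- three vertices lie in three increasing blocks of alternating sign, one in each.
module Submission where

open import Defs
open import Data.Nat using (ℕ; zero; suc; _≤_; _<_; z≤n; s≤s; _<?_)
import Data.Nat.Properties as ℕP
open import Data.Fin using (Fin; toℕ; inject₁; fromℕ; lower₁)
import Data.Fin as F
import Data.Fin.Properties as FP
open import Data.Integer using (ℤ; 0ℤ; ∣_∣; positive)
import Data.Integer as ℤ
import Data.Integer.Properties as ℤP
open import Data.List using (List; []; _∷_; length; lookup; take)
open import Data.List.Membership.Propositional using (_∈_)
open import Data.List.Relation.Unary.Any using (here; there)
open import Data.List.Relation.Binary.Permutation.Propositional using (_↭_; ↭-refl; ↭-prep; ↭-swap; ↭-sym)
open import Data.List.Relation.Binary.Permutation.Propositional.Properties using (∈-resp-↭; shift)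
open import Data.Product using (_×_; ∃-syntax; _,_; proj₁; proj₂)
open import Data.Sum using (_⊎_; inj₁; inj₂; [_,_])
import Data.Sum as Sum
open import Data.Empty using (⊥-elim)
open import Function using (_∘_)
open import Relation.Nullary using (¬_; yes; no; contradiction)
open import Relation.Binary using (tri<; tri≈; tri>)
open import Relation.Binary.PropositionalEquality using (_≡_; _≢_; refl; sym; trans; cong; subst; ≢-sym)

neg*pos<0 : ∀ {a b : ℤ} → a ℤ.< 0ℤ → 0ℤ ℤ.< b → a ℤ.* b ℤ.< 0ℤ
neg*pos<0 {b = b} a<0 b>0 = ℤP.*-monoʳ-<-pos b {{positive b>0}} a<0

pos*neg<0 : ∀ {a b : ℤ} → 0ℤ ℤ.< a → b ℤ.< 0ℤ → a ℤ.* b ℤ.< 0ℤ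
pos*neg<0 {a} {b} a>0 b<0 = subst (ℤ._< 0ℤ) (ℤP.*-comm b a) (neg*pos<0 b<0 a>0)

absSum-take-mono : ∀ (αs : List ℤ) {p q} → p ≤ q → absSum (take p αs) ≤ absSum (take q αs)
absSum-take-mono αs       {zero}          _         = z≤n
absSum-take-mono αs       {suc p} {zero}  ()
absSum-take-mono []       {suc p} {suc q} _         = z≤n
absSum-take-mono (α ∷ αs) {suc p} {suc q} (s≤s p≤q) = ℕP.+-monoʳ-≤ (∣ α ∣) (absSum-take-mono αs p≤q)

inBlock-cover : ∀ (αs : List ℤ) k → k < absSum αs → ∃[ i ] InBlock αs i k
inBlock-cover (α ∷ αs) k k<Σ with k <? ∣ α ∣
... | yes k<α = F.zero , z≤n , ℕP.<-≤-trans k<α (ℕP.m≤m+n ∣ α ∣ 0)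
... | no k≮α with ℕP.m≤n⇒∃[o]m+o≡n (ℕP.≮⇒≥ k≮α)
...   | j , refl with inBlock-cover αs j (ℕP.+-cancelˡ-< ∣ α ∣ j (absSum αs) k<Σ)
...     | i , lo , hi = F.suc i , ℕP.+-monoʳ-≤ (∣ α ∣) lo , ℕP.+-monoʳ-< (∣ α ∣) hi

inBlock-monotone : ∀ (αs : List ℤ) {i j k k′} → InBlock αs i k → InBlock αs j k′ → k ≤ k′ → i F.≤ j
inBlock-monotone αs {i} {j} {k} {k′} (lo , _) (_ , hi′) k≤k′ = ℕP.≮⇒≥ λ j<i →
  ℕP.<-irrefl refl (begin-strict
    k′                               <⟨ hi′ ⟩
    absSum (take (suc (toℕ j)) αs)   ≤⟨ absSum-take-mono αs j<i ⟩
    absSum (take (toℕ i) αs)         ≤⟨ lo ⟩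
    k                                ≤⟨ k≤k′ ⟩
    k′                               ∎)
  where open ℕP.≤-Reasoning

inBlock-unique : ∀ (αs : List ℤ) {i j k} → InBlock αs i k → InBlock αs j k → i ≡ j
inBlock-unique αs {i} {j} bi bj =
  FP.≤-antisym (inBlock-monotone αs {i} {j} bi bj ℕP.≤-refl) (inBlock-monotone αs {j} {i} bj bi ℕP.≤-refl)

MeetsAlternatingBlocks : ∀ {n m} (x : Fin m → Fin n) (αs : List ℤ) → List (Fin n) → Set
MeetsAlternatingBlocks x αs S =
  ∃[ i₁ ] ∃[ i₂ ] ∃[ i₃ ] (i₁ F.< i₂ × i₂ F.< i₃
    × MeetsOnce x αs i₁ S × MeetsOnce x αs i₂ S × MeetsOnce x αs i₃ S
    × lookup αs i₁ ℤ.* lookup αs i₂ ℤ.< 0ℤ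
    × lookup αs i₂ ℤ.* lookup αs i₃ ℤ.< 0ℤ)

module _ {n m} (x : Fin m → Fin n) (αs : List ℤ) where

  meetsOnce-resp-↭ : ∀ {i S S′} → S ↭ S′ → MeetsOnce x αs i S → MeetsOnce x αs i S′
  meetsOnce-resp-↭ S↭S′ (w , w∈S , w∈Xᵢ , only-w) =
    w , ∈-resp-↭ S↭S′ w∈S , w∈Xᵢ , λ w′ → only-w w′ ∘ ∈-resp-↭ (↭-sym S↭S′)

  meetsAlternatingBlocks-resp-↭ : ∀ {S S′} → S ↭ S′
    → MeetsAlternatingBlocks x αs S → MeetsAlternatingBlocks x αs S′
  meetsAlternatingBlocks-resp-↭ {S} {S′} S↭S′ (i₁ , i₂ , i₃ , i₁<i₂ , i₂<i₃ , once₁ , once₂ , once₃ , signs) =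
    i₁ , i₂ , i₃ , i₁<i₂ , i₂<i₃ , resp once₁ , resp once₂ , resp once₃ , signs
    where
    resp : ∀ {i} → MeetsOnce x αs i S → MeetsOnce x αs i S′
    resp = meetsOnce-resp-↭ S↭S′

isDiamond-rotate : ∀ {n} (T : Tournament n) {a b c d} → IsDiamond T a b c d → IsDiamond T b c a d
isDiamond-rotate T (a≢b , a≢c , a≢d , b≢c , b≢d , c≢d , a⇒b , b⇒c , c⇒a , d-side) =
  b≢c , ≢-sym a≢b , b≢d , ≢-sym a≢c , c≢d , a≢d , b⇒c , c⇒a , a⇒b ,
  Sum.map (λ (da , db , dc) → db , dc , da) (λ (ad , bd , cd) → bd , cd , ad) d-side

module _ {n m} (T : Tournament n) (u : Fin n) (x : Fin m → Fin n)
  (x-transitive : ∀ a b → a F.< b → Tournament._⇒_ T (x a) (x b))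
  (αs : List ℤ) (ψ : IsPsi T u x αs) where

  open Tournament T

  α : Fin (length αs) → ℤ
  α = lookup αs

  ⇒-order : ∀ {k k′} → x k ⇒ x k′ → k F.< k′
  ⇒-order {k} {k′} k⇒k′ with FP.<-cmp k k′
  ... | tri< k<k′ _ _ = k<k′
  ... | tri≈ _ refl _ = contradiction k⇒k′ (irrefl _)
  ... | tri> _ _ k′<k = contradiction (x-transitive _ _ k′<k) (asym _ _ k⇒k′)

  x-injective : ∀ {k k′} → x k ≡ x k′ → k ≡ k′
  x-injective {k} {k′} xk≡xk′ with FP.<-cmp k k′
  ... | tri< k<k′ _ _ = contradiction (subst (x k ⇒_) (sym xk≡xk′) (x-transitive _ _ k<k′)) (irrefl _)
  ... | tri≈ _ k≡k′ _ = k≡k′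
  ... | tri> _ _ k′<k = contradiction (subst (x k′ ⇒_) xk≡xk′ (x-transitive _ _ k′<k)) (irrefl _)

  no-3-cycle : ∀ {k₁ k₂ k₃} → x k₁ ⇒ x k₂ → x k₂ ⇒ x k₃ → ¬ (x k₃ ⇒ x k₁)
  no-3-cycle k₁⇒k₂ k₂⇒k₃ k₃⇒k₁ =
    FP.<-irrefl refl (FP.<-trans (⇒-order k₁⇒k₂) (FP.<-trans (⇒-order k₂⇒k₃) (⇒-order k₃⇒k₁)))

  inBlockOf : ∀ k → ∃[ i ] InBlock αs i (toℕ k)
  inBlockOf k = inBlock-cover αs (toℕ k) (subst (toℕ k <_) (sym (proj₁ (proj₂ ψ))) (FP.toℕ<n k))

  blockOf : Fin m → Fin (length αs)
  blockOf = proj₁ ∘ inBlockOf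

  blockOf-spec : ∀ k → InBlock αs (blockOf k) (toℕ k)
  blockOf-spec = proj₂ ∘ inBlockOf

  block-direction : ∀ i k → InBlock αs i (toℕ k) → (0ℤ ℤ.< α i → u ⇒ x k) × (α i ℤ.< 0ℤ → x k ⇒ u)
  block-direction = proj₂ (proj₂ (proj₂ ψ))

  u-adjacent : ∀ k → (u ⇒ x k) ⊎ (x k ⇒ u)
  u-adjacent k with ℤP.<-cmp (α (blockOf k)) 0ℤ
  ... | tri< α<0 _ _ = inj₂ (proj₂ (block-direction _ k (blockOf-spec k)) α<0)
  ... | tri≈ _ α≡0 _ = contradiction α≡0 (proj₁ ψ _)
  ... | tri> _ _ α>0 = inj₁ (proj₁ (block-direction _ k (blockOf-spec k)) α>0)

  x≢u : ∀ k → x k ≢ u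
  x≢u k xk≡u = [ irrefl u ∘ subst (u ⇒_) xk≡u , irrefl u ∘ subst (_⇒ u) xk≡u ] (u-adjacent k)

  dominates⇒positive : ∀ {i k} → InBlock αs i (toℕ k) → u ⇒ x k → 0ℤ ℤ.< α i
  dominates⇒positive {i} {k} b u⇒k with ℤP.<-cmp (α i) 0ℤ
  ... | tri< α<0 _ _ = contradiction (proj₂ (block-direction i k b) α<0) (asym _ _ u⇒k)
  ... | tri≈ _ α≡0 _ = contradiction α≡0 (proj₁ ψ i)
  ... | tri> _ _ α>0 = α>0

  dominated⇒negative : ∀ {i k} → InBlock αs i (toℕ k) → x k ⇒ u → α i ℤ.< 0ℤ
  dominated⇒negative {i} {k} b k⇒u with ℤP.<-cmp (α i) 0ℤ
  ... | tri< α<0 _ _ = α<0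
  ... | tri≈ _ α≡0 _ = contradiction α≡0 (proj₁ ψ i)
  ... | tri> _ _ α>0 = contradiction (proj₁ (block-direction i k b) α>0) (asym _ _ k⇒u)

  Opposed : Fin m → Fin m → Set
  Opposed k k′ = (u ⇒ x k × x k′ ⇒ u) ⊎ (x k ⇒ u × u ⇒ x k′)

  opposed⇒α*α<0 : ∀ {k k′} → Opposed k k′ → α (blockOf k) ℤ.* α (blockOf k′) ℤ.< 0ℤ
  opposed⇒α*α<0 (inj₁ (u⇒k , k′⇒u)) =
    pos*neg<0 (dominates⇒positive (blockOf-spec _) u⇒k) (dominated⇒negative (blockOf-spec _) k′⇒u)
  opposed⇒α*α<0 (inj₂ (k⇒u , u⇒k′)) =
    neg*pos<0 (dominated⇒negative (blockOf-spec _) k⇒u) (dominates⇒positive (blockOf-spec _) u⇒k′)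

  opposed⇒different-blocks : ∀ {i k k′} → Opposed k k′ → InBlock αs i (toℕ k) → ¬ InBlock αs i (toℕ k′)
  opposed⇒different-blocks (inj₁ (u⇒k , k′⇒u)) bk bk′ =
    ℤP.<-asym (dominates⇒positive bk u⇒k) (dominated⇒negative bk′ k′⇒u)
  opposed⇒different-blocks (inj₂ (k⇒u , u⇒k′)) bk bk′ =
    ℤP.<-asym (dominates⇒positive bk′ u⇒k′) (dominated⇒negative bk k⇒u)

  opposed⇒blockOf-< : ∀ {k k′} → x k ⇒ x k′ → Opposed k k′ → blockOf k F.< blockOf k′
  opposed⇒blockOf-< {k} {k′} k⇒k′ o = FP.≤∧≢⇒<
    (inBlock-monotone αs {blockOf k} {blockOf k′} (blockOf-spec k) (blockOf-spec k′) (ℕP.<⇒≤ (⇒-order k⇒k′)))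
    (λ same → opposed⇒different-blocks o (blockOf-spec k)
                (subst (λ i → InBlock αs i _) (sym same) (blockOf-spec k′)))

  meetsOnce-alone : ∀ {t s s′} → blockOf t ≢ blockOf s → blockOf t ≢ blockOf s′
    → MeetsOnce x αs (blockOf t) (u ∷ x t ∷ x s ∷ x s′ ∷ [])
  meetsOnce-alone {t} {s} {s′} t≁s t≁s′ = x t , there (here refl) , (t , refl , blockOf-spec t) , only-t
    where
    blockOf-resp : ∀ {k k′} → InBlock αs (blockOf t) (toℕ k) → x k ≡ x k′ → blockOf t ≡ blockOf k′
    blockOf-resp {k} b xk≡xk′ =
      trans (inBlock-unique αs {blockOf t} {blockOf k} b (blockOf-spec k)) (cong blockOf (x-injective xk≡xk′))

    only-t : ∀ w → w ∈ u ∷ x t ∷ x s ∷ x s′ ∷ [] → InBlockV x αs (blockOf t) w → w ≡ x t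
    only-t w (here w≡u)                      (k , refl , _) = contradiction w≡u (x≢u k)
    only-t w (there (here w≡t))              _              = w≡t
    only-t w (there (there (here w≡s)))      (k , refl , b) = contradiction (blockOf-resp b w≡s) t≁s
    only-t w (there (there (there (here w≡s′)))) (k , refl , b) = contradiction (blockOf-resp b w≡s′) t≁s′

  alternating-triple : ∀ {p q r} → x p ⇒ x q → x q ⇒ x r → Opposed p q → Opposed q r
    → MeetsAlternatingBlocks x αs (u ∷ x p ∷ x q ∷ x r ∷ [])
  alternating-triple {p} {q} {r} p⇒q q⇒r pq qr =
    blockOf p , blockOf q , blockOf r , p<q , q<r ,
    meetsOnce-alone (FP.<⇒≢ p<q) (FP.<⇒≢ p<r) ,
    meetsOnce-resp-↭ x αs (↭-prep u (↭-swap _ _ ↭-refl))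
      (meetsOnce-alone (≢-sym (FP.<⇒≢ p<q)) (FP.<⇒≢ q<r)) ,
    meetsOnce-resp-↭ x αs (↭-prep u (↭-sym (shift (x r) (x p ∷ x q ∷ []) [])))
      (meetsOnce-alone (≢-sym (FP.<⇒≢ p<r)) (≢-sym (FP.<⇒≢ q<r))) ,
    opposed⇒α*α<0 pq , opposed⇒α*α<0 qr
    where
    p<q : blockOf p F.< blockOf q
    p<q = opposed⇒blockOf-< p⇒q pq
    q<r : blockOf q F.< blockOf r
    q<r = opposed⇒blockOf-< q⇒r qr
    p<r : blockOf p F.< blockOf r
    p<r = FP.<-trans p<q q<r

  module _ (x-covers : ∀ w → w ≢ u → ∃[ k ] x k ≡ w) where

    diamond-through-u : ∀ {b c d} → IsDiamond T u b c d → MeetsAlternatingBlocks x αs (u ∷ b ∷ c ∷ d ∷ [])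
    diamond-through-u {b} {c} {d} (u≢b , u≢c , u≢d , _ , _ , _ , u⇒b , b⇒c , c⇒u , d-side)
      with x-covers b (≢-sym u≢b) | x-covers c (≢-sym u≢c) | x-covers d (≢-sym u≢d)
    ... | _ , refl | _ , refl | _ , refl with d-side
    ... | inj₁ (d⇒u , d⇒b , _) =
          meetsAlternatingBlocks-resp-↭ x αs (↭-prep u (↭-sym (shift d (b ∷ c ∷ []) [])))
            (alternating-triple d⇒b b⇒c (inj₂ (d⇒u , u⇒b)) (inj₁ (u⇒b , c⇒u)))
    ... | inj₂ (u⇒d , _ , c⇒d) = alternating-triple b⇒c c⇒d (inj₁ (u⇒b , c⇒u)) (inj₂ (c⇒u , u⇒d))

    no-3-cycle-avoiding-u : ∀ {a b c} → a ≢ u → b ≢ u → c ≢ u → a ⇒ b → b ⇒ c → ¬ (c ⇒ a)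
    no-3-cycle-avoiding-u {a} {b} {c} a≢u b≢u c≢u with x-covers a a≢u | x-covers b b≢u | x-covers c c≢u
    ... | _ , refl | _ , refl | _ , refl = no-3-cycle

    diamond-alternates : ∀ {a b c d} → IsDiamond T a b c d
      → u ∈ (a ∷ b ∷ c ∷ d ∷ []) × MeetsAlternatingBlocks x αs (a ∷ b ∷ c ∷ d ∷ [])
    diamond-alternates {a} {b} {c} {d} D@(_ , _ , _ , _ , _ , _ , a⇒b , b⇒c , c⇒a , _)
      with a F.≟ u | b F.≟ u | c F.≟ u
    ... | yes refl | _ | _ = here refl , diamond-through-u D
    ... | no _ | yes refl | _ = there (here refl) ,
          meetsAlternatingBlocks-resp-↭ x αs (shift a (b ∷ c ∷ []) (d ∷ []))
            (diamond-through-u (isDiamond-rotate T D))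
    ... | no _ | no _ | yes refl = there (there (here refl)) ,
          meetsAlternatingBlocks-resp-↭ x αs (↭-sym (shift c (a ∷ b ∷ []) (d ∷ [])))
            (diamond-through-u (isDiamond-rotate T (isDiamond-rotate T D)))
    ... | no a≢u | no b≢u | no c≢u = ⊥-elim (no-3-cycle-avoiding-u a≢u b≢u c≢u a⇒b b⇒c c⇒a)

inject₁-covers : ∀ {m} (w : Fin (suc m)) → w ≢ fromℕ m → ∃[ k ] inject₁ k ≡ w
inject₁-covers {m} w w≢m = lower₁ w m≢w , FP.inject₁-lower₁ w m≢w
  where
  m≢w : m ≢ toℕ w
  m≢w m≡w = w≢m (FP.toℕ-injective (trans (sym m≡w) (sym (FP.toℕ-fromℕ m))))

lemma2p9 : (m : ℕ) (T : Tournament (suc m))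
    → (∀ (a b : Fin m) → a F.< b → Tournament._⇒_ T (inject₁ a) (inject₁ b))
    → (αs : List ℤ) → IsPsi T (fromℕ m) inject₁ αs
    → (a b c d : Fin (suc m)) → IsDiamond T a b c d
    → (fromℕ m ∈ (a ∷ b ∷ c ∷ d ∷ []))
      × ∃[ i₁ ] ∃[ i₂ ] ∃[ i₃ ] (i₁ F.< i₂ × i₂ F.< i₃
          × MeetsOnce inject₁ αs i₁ (a ∷ b ∷ c ∷ d ∷ [])
          × MeetsOnce inject₁ αs i₂ (a ∷ b ∷ c ∷ d ∷ [])
          × MeetsOnce inject₁ αs i₃ (a ∷ b ∷ c ∷ d ∷ [])
          × lookup αs i₁ ℤ.* lookup αs i₂ ℤ.< 0ℤ
          × lookup αs i₂ ℤ.* lookup αs i₃ ℤ.< 0ℤ)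
lemma2p9 m T transitive αs ψ a b c d =
  diamond-alternates T (fromℕ m) inject₁ transitive αs ψ inject₁-covers
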